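{- Let $G$ be a graph and let $\mathfrak{C}$ be an acyclic cycle orientation configuration of $G$. Then the set of $\mathfrak{C}$-faithful orientations of $G$ is a system of representatives for the cycle reversal classes of orientations of $G$: every orientation of $G$ can be transformed by a sequence of cycle reversals into exactly one $\mathfrak{C}$-faithful orientation.
   Context: Graphs are finite and connected, possibly with parallel edges but without loops; cycles are simple. Edges have reference orientations and an oriented cycle $C$ is identified with $\sum_{e\in C}\pm e$ in the free abelian group (or real vector space) on $E(G)$, the sign being $+$ iff $C$ traverses $e$ along its reference orientation. A cycle orientation configuration $\mathfrak{C}$ assigns an orientation to each cycle of $G$; it is acyclic if, with $C_1,\ldots,C_t$ the cycles oriented as in $\mathfrak{C}$, the equation $n_1C_1+\cdots+n_tC_t=0$ has no nonnegative integer solution other than $0$. Given an orientation $\mathcal{O}$ of $G$ (each edge directed), a cycle reversal reverses all edges of a directed cycle of $\mathcal{O}$; two orientations are in the same cycle reversal class if one is obtained from the other by a sequence of cycle reversals. An orientation $\mathcal{O}$ is $\mathfrak{C}$-faithful if every directed cycle of $\mathcal{O}$ is oriented as in $\mathfrak{C}$. -}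

module Defs where

open import Data.Nat using (ℕ; zero; suc)
open import Data.Fin using (Fin; zero; suc; _≟_)
open import Data.Bool using (Bool; true; false; not; if_then_else_)
open import Data.Integer using (ℤ; _+_; -_; 0ℤ; 1ℤ; -1ℤ)
open import Data.Vec using (Vec; tabulate; lookup; zipWith; replicate; map)
open import Data.List using (List; foldr; allFin)
open import Data.Product using (Σ; _×_; _,_; ∃)
open import Function.Definitions using (Injective)
open import Relation.Binary.PropositionalEquality using (_≡_; _≢_)
open import Relation.Nullary using (does)
open import Relation.Binary.Construct.Closure.ReflexiveTransitive using (Star)

-- Graphs: finite, loopless, parallel edges allowed.
-- Vertices Fin n, edges Fin m; edge e has reference orientation
-- tl e → hd e.

record Graph : Set where
  field
    n      : ℕ
    m      : ℕ
    tl     : Fin m → Fin n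
    hd     : Fin m → Fin n
    noLoop : ∀ e → tl e ≢ hd e

open Graph public

Adjacent : (G : Graph) → Fin (n G) → Fin (n G) → Set
Adjacent G u v = Σ (Fin (m G)) λ e → (tl G e ≡ u × hd G e ≡ v) Data.Sum.⊎ (tl G e ≡ v × hd G e ≡ u)
  where import Data.Sum

Connected : Graph → Set
Connected G = ∀ u v → Star (Adjacent G) u v

cycNext : ∀ {k} → Fin (suc k) → Fin (suc k)
cycNext {zero}  zero    = zero
cycNext {suc k} zero    = suc zero
cycNext {suc k} (suc i) with cycNext {k} i
... | zero  = zero
... | suc j = suc (suc j)

sumFin : ∀ {k} → (Fin k → ℤ) → ℤ
sumFin {k} f = foldr (λ i acc → f i + acc) 0ℤ (allFin k)

-- sign of traversing an edge: true = along the reference orientation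
sgn : Bool → ℤ
sgn true  = 1ℤ
sgn false = -1ℤ

-- An oriented (simple) cycle of length ℓ = suc (suc k) ≥ 2:
-- distinct vertices vx 0, …, vx (ℓ-1), distinct edges ed 0, …, ed (ℓ-1),
-- step i traverses edge ed i from vx i to vx (i+1 mod ℓ), along the
-- reference orientation iff dir i ≡ true.

record OrientedCycle (G : Graph) : Set where
  field
    k      : ℕ
    vx     : Fin (suc (suc k)) → Fin (n G)
    ed     : Fin (suc (suc k)) → Fin (m G)
    dir    : Fin (suc (suc k)) → Bool
    vx-inj : Injective _≡_ _≡_ vx
    ed-inj : Injective _≡_ _≡_ ed
    step   : ∀ i → if dir i
                     then (tl G (ed i) ≡ vx i × hd G (ed i) ≡ vx (cycNext i))
                     else (hd G (ed i) ≡ vx i × tl G (ed i) ≡ vx (cycNext i))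

cycleVec : {G : Graph} → OrientedCycle G → Vec ℤ (m G)
cycleVec {G} C = tabulate λ e →
  sumFin λ i → if does (OrientedCycle.ed C i ≟ e) then sgn (OrientedCycle.dir C i) else 0ℤ
  where open OrientedCycle

IsOCycle : (G : Graph) → Vec ℤ (m G) → Set
IsOCycle G c = Σ (OrientedCycle G) λ C → cycleVec C ≡ c

negV : ∀ {l} → Vec ℤ l → Vec ℤ l
negV = map -_

sumVecs : ∀ {l} → List (Vec ℤ l) → Vec ℤ l
sumVecs {l} = foldr (zipWith _+_) (replicate l 0ℤ)

-- Cycle orientation configurations.
-- 𝔠 c ≡ true means: the cycle underlying c is oriented as c in 𝔠.
-- Well-formedness: each cycle gets exactly one of its two orientations.

CycleOrientationConfig : Graph → Set
CycleOrientationConfig G = Vec ℤ (m G) → Bool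

IsCOC : (G : Graph) → CycleOrientationConfig G → Set
IsCOC G 𝔠 = ∀ c → IsOCycle G c → 𝔠 c ≢ 𝔠 (negV c)

-- acyclic: no nonnegative integer combination Σ nᵢ Cᵢ of the cycles
-- oriented as in 𝔠 vanishes except the trivial one.  A combination with
-- coefficients nᵢ ∈ ℕ is given as a finite list (with multiplicities) of
-- such oriented cycles.
Acyclic : (G : Graph) → CycleOrientationConfig G → Set
Acyclic G 𝔠 = (cs : List (Vec ℤ (m G))) →
  Data.List.Relation.Unary.All.All (λ c → IsOCycle G c × 𝔠 c ≡ true) cs →
  sumVecs cs ≡ replicate (m G) 0ℤ → cs ≡ Data.List.[]
  where import Data.List.Relation.Unary.All

-- Orientations: O e ≡ true iff e is directed along its reference orientation.

Orientation : Graph → Set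
Orientation G = Vec Bool (m G)

DirectedCycle : (G : Graph) → Orientation G → Vec ℤ (m G) → Set
DirectedCycle G O c = IsOCycle G c ×
  (∀ e → (lookup c e ≡ 1ℤ → lookup O e ≡ true) × (lookup c e ≡ -1ℤ → lookup O e ≡ false))

reverseAlong : (G : Graph) → Orientation G → Vec ℤ (m G) → Orientation G
reverseAlong G O c = zipWith (λ b z → if does (z Data.Integer.≟ 0ℤ) then b else not b) O c

CycleReversal : (G : Graph) → Orientation G → Orientation G → Set
CycleReversal G O O' = Σ (Vec ℤ (m G)) λ c → DirectedCycle G O c × O' ≡ reverseAlong G O c

Reaches : (G : Graph) → Orientation G → Orientation G → Set
Reaches G = Star (CycleReversal G)

Faithful : (G : Graph) → CycleOrientationConfig G → Orientation G → Set
Faithful G 𝔠 O = ∀ c → DirectedCycle G O c → 𝔠 c ≡ true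

module Submission where

-- Write sgn(P) ∈ {±1}^E for an orientation P (+1 on edges directed along their
-- reference orientation).  Reversing a directed cycle c of P replaces sgn(P) by
-- sgn(P) - 2c, and the net in-degree ∂P(v) = Σ_e sgn(P)_e · inc(e,v) is unchanged
-- because every cycle vector has zero boundary.
--
-- Uniqueness.  If P, Q are faithful with ∂P = ∂Q and differ on some edge, then on the
-- edges where they differ every vertex has as many P-incoming as P-outgoing edges, so
-- walking along such edges in P closes up a cycle C that is directed in P, while -C is
-- directed in Q.  Faithfulness orients both C and -C as in 𝔠, which is impossible.
--
-- Existence.  Whether P has a directed cycle oriented against 𝔠 is decidable (oriented
-- cycles have length ≤ |E| and are searched exhaustively); while one exists, reverse it.
-- Each such reversal adds 2(-c) to sgn(P) with -c oriented as in 𝔠, so an orientation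
-- met twice would give a nontrivial vanishing nonnegative combination of 𝔠-oriented
-- cycles, contradicting acyclicity.  Since there are only 2^|E| orientations, the
-- process reaches a faithful orientation within 2^|E| steps.

open import Defs
open import Data.Bool using (Bool; true; false; not; if_then_else_)
import Data.Bool.Properties as BoolP
open import Data.Empty using (⊥; ⊥-elim)
open import Data.Fin as Fin using (Fin; zero; suc; toℕ; opposite)
import Data.Fin.Properties as FinP
open import Data.Integer as ℤ using (ℤ; 0ℤ; 1ℤ; -1ℤ; +_; -_; _+_; _-_; _*_)
import Data.Integer.Properties as ℤP
open import Algebra.Properties.Semiring.Sum ℤP.+-*-semiring
  using (sum; sum-cong-≗; sum-replicate-zero; ∑-distrib-+; ∑-comm; *-distribˡ-sum; *-distribʳ-sum)
open import Data.Integer.Tactic.RingSolver using (solve-∀)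
open import Data.List as List using (List; []; _∷_)
open import Data.List.Relation.Unary.All using (All; []; _∷_)
open import Data.Nat as ℕ using (ℕ; zero; suc; s≤s; z≤n; _^_)
import Data.Nat.Properties as ℕP
open import Data.Product using (Σ; _×_; _,_; proj₁; proj₂)
open import Data.Sum using (_⊎_; inj₁; inj₂; [_,_]′)
open import Data.Vec as Vec using (Vec; lookup; tabulate)
import Data.Vec.Properties as VecP
open import Function using (_∘_; id)
open import Function.Definitions using (Injective)
open import Relation.Binary.Definitions using (tri<; tri≈; tri>)
open import Relation.Binary.PropositionalEquality
open import Relation.Binary.Construct.Closure.ReflexiveTransitive as Star using (Star; ε; _◅_; _◅◅_)
open import Relation.Nullary using (Dec; yes; no; does; ¬_; ¬?)
open import Relation.Nullary.Decidable using (decidable-stable; _×-dec_; _→-dec_)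

foldr-tabulate≡sum : ∀ {k j} (g : Fin k → Fin j) (f : Fin j → ℤ) →
  List.foldr (λ i acc → f i + acc) 0ℤ (List.tabulate g) ≡ sum (f ∘ g)
foldr-tabulate≡sum {zero}  g f = refl
foldr-tabulate≡sum {suc k} g f = cong (_+_ (f (g zero))) (foldr-tabulate≡sum (g ∘ suc) f)

sumFin≡sum : ∀ {k} (f : Fin k → ℤ) → sumFin f ≡ sum f
sumFin≡sum f = foldr-tabulate≡sum id f

sum-zeros : ∀ {k} (f : Fin k → ℤ) → (∀ i → f i ≡ 0ℤ) → sum f ≡ 0ℤ
sum-zeros {k} f f≡0 = trans (sum-cong-≗ f≡0) (sum-replicate-zero k)

sum-single : ∀ {k} (f : Fin k → ℤ) (i : Fin k) → (∀ j → j ≢ i → f j ≡ 0ℤ) → sum f ≡ f i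
sum-single {suc k} f zero others
  rewrite sum-zeros (f ∘ suc) (λ j → others (suc j) (λ ())) = ℤP.+-identityʳ (f zero)
sum-single {suc k} f (suc i) others rewrite others zero (λ ()) =
  trans (ℤP.+-identityˡ _)
        (sum-single (f ∘ suc) i (λ j j≢i → others (suc j) (j≢i ∘ FinP.suc-injective)))

sum-neg : ∀ {k} (f : Fin k → ℤ) → sum (λ i → - f i) ≡ - sum f
sum-neg f = begin
  sum (λ i → - f i)       ≡⟨ sum-cong-≗ (λ i → sym (ℤP.-1*i≡-i (f i))) ⟩
  sum (λ i → -1ℤ * f i)   ≡⟨ sym (*-distribˡ-sum -1ℤ f) ⟩
  -1ℤ * sum f             ≡⟨ ℤP.-1*i≡-i (sum f) ⟩
  - sum f                 ∎
  where open ≡-Reasoning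

sum-sub : ∀ {k} (f g : Fin k → ℤ) → sum (λ i → f i - g i) ≡ sum f - sum g
sum-sub f g = trans (∑-distrib-+ f (λ i → - g i)) (cong (_+_ (sum f)) (sum-neg g))

sum-nonneg : ∀ {k} (f : Fin k → ℤ) → (∀ i → 0ℤ ℤ.≤ f i) → 0ℤ ℤ.≤ sum f
sum-nonneg {zero}  f f≥0 = ℤP.≤-refl
sum-nonneg {suc k} f f≥0 = ℤP.+-mono-≤ (f≥0 zero) (sum-nonneg (f ∘ suc) (f≥0 ∘ suc))

term≤sum : ∀ {k} (f : Fin k → ℤ) → (∀ i → 0ℤ ℤ.≤ f i) → ∀ i → f i ℤ.≤ sum f
term≤sum {suc k} f f≥0 zero =
  subst (ℤ._≤ sum f) (ℤP.+-identityʳ (f zero))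
        (ℤP.+-monoʳ-≤ (f zero) (sum-nonneg (f ∘ suc) (f≥0 ∘ suc)))
term≤sum {suc k} f f≥0 (suc i) =
  ℤP.≤-trans (term≤sum (f ∘ suc) (f≥0 ∘ suc) i)
             (subst (ℤ._≤ sum f) (ℤP.+-identityˡ (sum (f ∘ suc)))
                    (ℤP.+-monoˡ-≤ (sum (f ∘ suc)) (f≥0 zero)))

twice≡0 : ∀ {x} → + 2 * x ≡ 0ℤ → x ≡ 0ℤ
twice≡0 eq with ℤP.i*j≡0⇒i≡0∨j≡0 (+ 2) eq
... | inj₂ x≡0 = x≡0

vec-ext : ∀ {A : Set} {l} (x y : Vec A l) → (∀ i → lookup x i ≡ lookup y i) → x ≡ y
vec-ext x y x≗y =
  trans (sym (VecP.tabulate∘lookup x)) (trans (VecP.tabulate-cong x≗y) (VecP.tabulate∘lookup y))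

sgn-not : ∀ b → sgn (not b) ≡ - sgn b
sgn-not true  = refl
sgn-not false = refl

sgn≡1 : ∀ {b} → sgn b ≡ 1ℤ → b ≡ true
sgn≡1 {true} _ = refl

sgn≡-1 : ∀ {b} → sgn b ≡ -1ℤ → b ≡ false
sgn≡-1 {false} _ = refl

cycNext-toℕ : ∀ {k} (i : Fin (suc k)) →
  (toℕ i ≡ k × cycNext i ≡ zero) ⊎ (toℕ i ℕ.< k × toℕ (cycNext i) ≡ suc (toℕ i))
cycNext-toℕ {zero}  zero = inj₁ (refl , refl)
cycNext-toℕ {suc k} zero = inj₂ (s≤s z≤n , refl)
cycNext-toℕ {suc k} (suc i) with cycNext {k} i | cycNext-toℕ {k} i
... | zero  | inj₁ (i≡k , _) = inj₁ (cong suc i≡k , refl)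
... | suc j | inj₂ (i<k , eq) = inj₂ (s≤s i<k , cong suc eq)

sum-cycNext : ∀ {k} (f : Fin (suc k) → ℤ) → sum (f ∘ cycNext) ≡ sum f
sum-cycNext {zero}  f = refl
sum-cycNext {suc k} f =
  trans (cong (_+_ (f (suc zero))) (trans (sum-cong-≗ shifted) (sum-cycNext f′)))
        (swap (f (suc zero)) (f zero) (sum (λ i → f (suc (suc i)))))
  where
  f′ : Fin (suc k) → ℤ
  f′ zero    = f zero
  f′ (suc j) = f (suc (suc j))
  shifted : ∀ i → f (cycNext {suc k} (suc i)) ≡ f′ (cycNext {k} i)
  shifted i with cycNext {k} i
  ... | zero  = refl
  ... | suc j = refl
  swap : ∀ a b c → a + (b + c) ≡ b + (a + c)
  swap = solve-∀

cycNext-opposite : ∀ {k} (j : Fin (suc k)) → cycNext (opposite (cycNext j)) ≡ opposite j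
cycNext-opposite {k} j = FinP.toℕ-injective (by-cases (cycNext-toℕ j))
  where
  opp : ∀ (i : Fin (suc k)) → toℕ (opposite i) ≡ k ℕ.∸ toℕ i
  opp = FinP.opposite-prop
  k∸suc≢k : ∀ {k} t → t ℕ.< k → k ℕ.∸ suc t ≢ k
  k∸suc≢k {suc k} t _ eq = ℕP.1+n≰n (subst (ℕ._≤ suc k) (cong suc eq) (s≤s (ℕP.m∸n≤m k t)))
  by-cases : (toℕ j ≡ k × cycNext j ≡ zero) ⊎ (toℕ j ℕ.< k × toℕ (cycNext j) ≡ suc (toℕ j)) →
             toℕ (cycNext (opposite (cycNext j))) ≡ toℕ (opposite j)
  by-cases (inj₁ (j≡k , next≡0)) rewrite next≡0 | opp j | j≡k | ℕP.n∸n≡0 k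
    with cycNext-toℕ (opposite (zero {k}))
  ... | inj₁ (_ , eq) rewrite eq = refl
  ... | inj₂ (lt , _) rewrite opp (zero {k}) = ⊥-elim (ℕP.<-irrefl refl lt)
  by-cases (inj₂ (j<k , next≡)) with cycNext-toℕ (opposite (cycNext j))
  ... | inj₁ (eq , _) rewrite opp (cycNext j) | next≡ | opp j = ⊥-elim (k∸suc≢k (toℕ j) j<k eq)
  ... | inj₂ (_ , eq) rewrite eq | opp (cycNext j) | next≡ | opp j = sym (ℕP.+-∸-assoc 1 j<k)

-- Step j of the reversed cycle traverses the edge of step 'mirror j' of the original.
mirror : ∀ {k} → Fin (suc k) → Fin (suc k)
mirror j = opposite (cycNext j)

mirror-involutive : ∀ {k} (j : Fin (suc k)) → mirror (mirror j) ≡ j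
mirror-involutive j = trans (cong opposite (cycNext-opposite j)) (FinP.opposite-involutive j)

involution-injective : ∀ {A : Set} (f : A → A) → (∀ x → f (f x) ≡ x) → Injective _≡_ _≡_ f
involution-injective f inv {x} {y} fx≡fy = trans (sym (inv x)) (trans (cong f fx≡fy) (inv y))

step-backwards : ∀ {N} b {t h x y : Fin N} →
  (if b then (t ≡ x × h ≡ y) else (h ≡ x × t ≡ y)) →
  (if not b then (t ≡ y × h ≡ x) else (h ≡ y × t ≡ x))
step-backwards true  (p , q) = q , p
step-backwards false (p , q) = q , p

module _ {G : Graph} where
  open OrientedCycle

  reverse : OrientedCycle G → OrientedCycle G
  reverse C = record
    { k      = k C
    ; vx     = λ j → vx C (opposite j)
    ; ed     = λ j → ed C (mirror j)
    ; dir    = λ j → not (dir C (mirror j))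
    ; vx-inj = involution-injective opposite FinP.opposite-involutive ∘ vx-inj C
    ; ed-inj = involution-injective mirror mirror-involutive ∘ ed-inj C
    ; step   = λ j → subst (reversed-step j) (cong (vx C) (cycNext-opposite j))
                           (step-backwards (dir C (mirror j)) (step C (mirror j)))
    }
    where
    reversed-step : Fin (suc (suc (k C))) → Fin (n G) → Set
    reversed-step j z = let e = ed C (mirror j) in
      if not (dir C (mirror j)) then (tl G e ≡ z × hd G e ≡ vx C (mirror j))
                                else (hd G e ≡ z × tl G e ≡ vx C (mirror j))

  traversal : (C : OrientedCycle G) → Fin (m G) → Fin (suc (suc (k C))) → ℤ
  traversal C e a = if does (ed C a Fin.≟ e) then sgn (dir C a) else 0ℤ

  entry : OrientedCycle G → Fin (m G) → ℤ
  entry C e = lookup (cycleVec C) e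

  entry≡sum : ∀ C e → entry C e ≡ sum (traversal C e)
  entry≡sum C e = trans (VecP.lookup∘tabulate _ e) (sumFin≡sum (traversal C e))

  traversal-own : ∀ C a → traversal C (ed C a) a ≡ sgn (dir C a)
  traversal-own C a with ed C a Fin.≟ ed C a
  ... | yes _ = refl
  ... | no ne = ⊥-elim (ne refl)

  traversal-other : ∀ C e a → ed C a ≢ e → traversal C e a ≡ 0ℤ
  traversal-other C e a ne with ed C a Fin.≟ e
  ... | yes eq = ⊥-elim (ne eq)
  ... | no _   = refl

  -- As C uses each edge at most once, the e-th entry of its vector is the sign of
  -- the step traversing e, or 0 if C avoids e.
  entry-cases : ∀ C e →
    (Σ (Fin (suc (suc (k C)))) λ a → ed C a ≡ e × entry C e ≡ sgn (dir C a))
    ⊎ ((∀ a → ed C a ≢ e) × entry C e ≡ 0ℤ)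
  entry-cases C e with FinP.any? (λ a → ed C a Fin.≟ e)
  ... | yes (a , refl) = inj₁ (a , refl , trans (entry≡sum C e)
          (trans (sum-single _ a (λ j j≢a → traversal-other C e j (j≢a ∘ ed-inj C)))
                 (traversal-own C a)))
  ... | no avoids = inj₂ ((λ a eq → avoids (a , eq)) ,
          trans (entry≡sum C e) (sum-zeros _ (λ j → traversal-other C e j (λ eq → avoids (j , eq)))))

  entry-reverse : ∀ C e → entry (reverse C) e ≡ - entry C e
  entry-reverse C e with entry-cases (reverse C) e | entry-cases C e
  ... | inj₁ (j , p , q) | inj₁ (a , p′ , q′) rewrite ed-inj C (trans p (sym p′)) =
    trans q (trans (sgn-not _) (cong -_ (sym q′)))
  ... | inj₁ (j , p , _) | inj₂ (avoids , _) = ⊥-elim (avoids (mirror j) p)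
  ... | inj₂ (avoids , _) | inj₁ (a , p′ , _) =
    ⊥-elim (avoids (mirror a) (trans (cong (ed C) (mirror-involutive a)) p′))
  ... | inj₂ (_ , q) | inj₂ (_ , q′) rewrite q | q′ = refl

  cycleVec-reverse : ∀ (C : OrientedCycle G) → cycleVec (reverse C) ≡ negV (cycleVec C)
  cycleVec-reverse C = vec-ext _ _ λ e →
    trans (entry-reverse C e) (sym (VecP.lookup-map e -_ (cycleVec C)))

  negV-cycle : ∀ c → IsOCycle G c → IsOCycle G (negV c)
  negV-cycle c (C , refl) = reverse C , cycleVec-reverse C

  agrees⇒directed : (P : Orientation G) (C : OrientedCycle G) →
    (∀ a → dir C a ≡ lookup P (ed C a)) → DirectedCycle G P (cycleVec C)
  agrees⇒directed P C agrees = (C , refl) , λ e → forward e , backward e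
    where
    forward : ∀ e → entry C e ≡ 1ℤ → lookup P e ≡ true
    forward e eq with entry-cases C e
    ... | inj₁ (a , refl , q) = trans (sym (agrees a)) (sgn≡1 (trans (sym q) eq))
    ... | inj₂ (_ , q) with trans (sym q) eq
    ... | ()
    backward : ∀ e → entry C e ≡ -1ℤ → lookup P e ≡ false
    backward e eq with entry-cases C e
    ... | inj₁ (a , refl , q) = trans (sym (agrees a)) (sgn≡-1 (trans (sym q) eq))
    ... | inj₂ (_ , q) with trans (sym q) eq
    ... | ()

  entry-values : ∀ (C : OrientedCycle G) e → entry C e ≡ 0ℤ ⊎ entry C e ≡ 1ℤ ⊎ entry C e ≡ -1ℤ
  entry-values C e with entry-cases C e
  ... | inj₂ (_ , q) = inj₁ q
  ... | inj₁ (a , _ , q) with dir C a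
  ...   | true  = inj₂ (inj₁ q)
  ...   | false = inj₂ (inj₂ q)

  sgn-reverseAlong : ∀ P c → DirectedCycle G P c → ∀ e →
    sgn (lookup (reverseAlong G P c) e) ≡ sgn (lookup P e) - + 2 * lookup c e
  sgn-reverseAlong P c ((C , refl) , directed) e =
    trans (cong sgn (VecP.lookup-zipWith _ e P c))
          (sgn-flip (lookup P e) (entry C e) (entry-values C e)
                    (proj₁ (directed e)) (proj₂ (directed e)))
    where
    sgn-flip : ∀ b z → z ≡ 0ℤ ⊎ z ≡ 1ℤ ⊎ z ≡ -1ℤ →
      (z ≡ 1ℤ → b ≡ true) → (z ≡ -1ℤ → b ≡ false) →
      sgn (if does (z ℤ.≟ 0ℤ) then b else not b) ≡ sgn b - + 2 * z
    sgn-flip b z (inj₁ refl)        _  _  = sym (ℤP.+-identityʳ (sgn b))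
    sgn-flip b z (inj₂ (inj₁ refl)) fw _  rewrite fw refl = refl
    sgn-flip b z (inj₂ (inj₂ refl)) _  bw rewrite bw refl = refl

infix 6 _≐_
_≐_ : ∀ {N} → Fin N → Fin N → ℤ
u ≐ v = if does (u Fin.≟ v) then 1ℤ else 0ℤ

≐-nonneg : ∀ {N} (u v : Fin N) → 0ℤ ℤ.≤ u ≐ v
≐-nonneg u v with u Fin.≟ v
... | yes _ = ℤ.+≤+ z≤n
... | no _  = ℤ.+≤+ z≤n

≐-self : ∀ {N} (u : Fin N) → u ≐ u ≡ 1ℤ
≐-self u with u Fin.≟ u
... | yes _ = refl
... | no ne = ⊥-elim (ne refl)

≐≢0 : ∀ {N} (u v : Fin N) → u ≐ v ≢ 0ℤ → u ≡ v
≐≢0 u v ne with u Fin.≟ v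
... | yes eq = eq
... | no _   = ⊥-elim (ne refl)

inc : (G : Graph) → Fin (m G) → Fin (n G) → ℤ
inc G e v = (hd G e ≐ v) - (tl G e ≐ v)

-- The boundary of P: ∂ G P v is the in-degree minus the out-degree of v in P.
∂ : (G : Graph) → Orientation G → Fin (n G) → ℤ
∂ G P v = sum (λ e → sgn (lookup P e) * inc G e v)

module _ {G : Graph} where
  open OrientedCycle

  step-incidence : ∀ b e x y v →
    (if b then (tl G e ≡ x × hd G e ≡ y) else (hd G e ≡ x × tl G e ≡ y)) →
    sgn b * inc G e v ≡ (y ≐ v) - (x ≐ v)
  step-incidence true  e x y v (refl , refl) = ℤP.*-identityˡ _
  step-incidence false e x y v (refl , refl) = flip-sign (x ≐ v) (y ≐ v)
    where
    flip-sign : ∀ a b → -1ℤ * (a - b) ≡ b - a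
    flip-sign = solve-∀

  -- Every cycle vector has zero boundary: the signed incidences of consecutive
  -- steps telescope around the cycle.
  cycle-boundary : ∀ (C : OrientedCycle G) v → sum (λ e → entry C e * inc G e v) ≡ 0ℤ
  cycle-boundary C v = begin
    sum (λ e → entry C e * inc G e v)
      ≡⟨ sum-cong-≗ (λ e → trans (cong (_* inc G e v) (entry≡sum C e))
                                 (*-distribʳ-sum (inc G e v) (traversal C e))) ⟩
    sum (λ e → sum (λ a → traversal C e a * inc G e v))
      ≡⟨ ∑-comm (λ e a → traversal C e a * inc G e v) ⟩
    sum (λ a → sum (λ e → traversal C e a * inc G e v))
      ≡⟨ sum-cong-≗ (λ a → sum-single _ (ed C a) (λ e ne →
           trans (cong (_* inc G e v) (traversal-other C e a (ne ∘ sym))) (ℤP.*-zeroˡ (inc G e v)))) ⟩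
    sum (λ a → traversal C (ed C a) a * inc G (ed C a) v)
      ≡⟨ sum-cong-≗ (λ a → trans (cong (_* inc G (ed C a) v) (traversal-own C a))
           (step-incidence (dir C a) (ed C a) (vx C a) (vx C (cycNext a)) v (step C a))) ⟩
    sum (λ a → (vx C (cycNext a) ≐ v) - (vx C a ≐ v))
      ≡⟨ sum-sub (λ a → vx C (cycNext a) ≐ v) (λ a → vx C a ≐ v) ⟩
    sum (λ a → vx C (cycNext a) ≐ v) - sum (λ a → vx C a ≐ v)
      ≡⟨ cong (_- sum (λ a → vx C a ≐ v)) (sum-cycNext (λ a → vx C a ≐ v)) ⟩
    sum (λ a → vx C a ≐ v) - sum (λ a → vx C a ≐ v)
      ≡⟨ ℤP.+-inverseʳ (sum (λ a → vx C a ≐ v)) ⟩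
    0ℤ ∎
    where open ≡-Reasoning

  ∂-reverseAlong : ∀ P c → DirectedCycle G P c → ∀ v → ∂ G (reverseAlong G P c) v ≡ ∂ G P v
  ∂-reverseAlong P c directed@((C , refl) , _) v = begin
    ∂ G (reverseAlong G P c) v
      ≡⟨ sum-cong-≗ (λ e → trans (cong (_* inc G e v) (sgn-reverseAlong P c directed e))
                                 (distrib (sgn (lookup P e)) (entry C e) (inc G e v))) ⟩
    sum (λ e → sgn (lookup P e) * inc G e v - + 2 * (entry C e * inc G e v))
      ≡⟨ sum-sub (λ e → sgn (lookup P e) * inc G e v) (λ e → + 2 * (entry C e * inc G e v)) ⟩
    ∂ G P v - sum (λ e → + 2 * (entry C e * inc G e v))
      ≡⟨ cong (_-_ (∂ G P v)) (trans (sym (*-distribˡ-sum (+ 2) (λ e → entry C e * inc G e v)))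
                                (cong (+ 2 *_) (cycle-boundary C v))) ⟩
    ∂ G P v - + 2 * 0ℤ
      ≡⟨ ℤP.+-identityʳ (∂ G P v) ⟩
    ∂ G P v ∎
    where
    open ≡-Reasoning
    distrib : ∀ s c i → (s - + 2 * c) * i ≡ s * i - + 2 * (c * i)
    distrib = solve-∀

  ∂-Reaches : ∀ {P Q} → Reaches G P Q → ∀ v → ∂ G P v ≡ ∂ G Q v
  ∂-Reaches ε v = refl
  ∂-Reaches {P} ((c , directed , refl) ◅ rest) v =
    trans (sym (∂-reverseAlong P c directed v)) (∂-Reaches rest v)

InjectiveBelow : ∀ {A : Set} → (ℕ → A) → ℕ → Set
InjectiveBelow u j = ∀ a b → a ℕ.< b → b ℕ.< j → u a ≢ u b

first-repetition : ∀ {N} (u : ℕ → Fin N) →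
  Σ ℕ λ i → Σ ℕ λ j → i ℕ.< j × u i ≡ u j × InjectiveBelow u j
first-repetition {N} u = search (suc N) 0 (ℕP.+-identityʳ (suc N)) (λ _ _ _ ())
  where
  pigeonhole : ¬ InjectiveBelow u (suc N)
  pigeonhole injective with FinP.pigeonhole (ℕP.n<1+n N) (u ∘ toℕ)
  ... | i , j , i<j , eq = injective (toℕ i) (toℕ j) i<j (FinP.toℕ<n j) eq
  -- fuel + j ≡ suc N bounds the number of indices still to be inspected
  search : ∀ fuel j → fuel ℕ.+ j ≡ suc N → InjectiveBelow u j →
           Σ ℕ λ i → Σ ℕ λ j → i ℕ.< j × u i ≡ u j × InjectiveBelow u j
  search zero j eq injective = ⊥-elim (pigeonhole (subst (InjectiveBelow u) eq injective))
  search (suc fuel) j eq injective with FinP.any? (λ (a : Fin j) → u (toℕ a) Fin.≟ u j)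
  ... | yes (a , ua≡uj) = toℕ a , j , FinP.toℕ<n a , ua≡uj , injective
  ... | no fresh = search fuel (suc j) (trans (ℕP.+-suc fuel j) eq) extended
    where
    extended : InjectiveBelow u (suc j)
    extended a b a<b b<1+j with ℕP.m≤n⇒m<n∨m≡n (ℕP.≤-pred b<1+j)
    ... | inj₁ b<j  = injective a b a<b b<j
    ... | inj₂ refl = λ ua≡ub → fresh (Fin.fromℕ< a<b , trans (cong u (FinP.toℕ-fromℕ< a<b)) ua≡ub)

-- For an edge directed b by P and c by Q, with h = [its head is v] and t = [its tail
-- is v]: 'entering' is 1 iff P and Q differ on it and P directs it into v; 'leaving'
-- is 1 iff they differ and P directs it out of v.
entering leaving : Bool → Bool → ℤ → ℤ → ℤ
entering true  false h t = h
entering false true  h t = t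
entering _     _     _ _ = 0ℤ
leaving  true  false h t = t
leaving  false true  h t = h
leaving  _     _     _ _ = 0ℤ

-- The contribution of such an edge to ∂P v - ∂Q v.
sgn-difference : ∀ b c h t →
  (sgn b - sgn c) * (h - t) ≡ + 2 * (entering b c h t - leaving b c h t)
sgn-difference true  true  h t = ℤP.*-zeroˡ (h - t)
sgn-difference true  false h t = refl
sgn-difference false true  h t = negate h t
  where
  negate : ∀ h t → (-1ℤ - 1ℤ) * (h - t) ≡ + 2 * (t - h)
  negate = solve-∀
sgn-difference false false h t = ℤP.*-zeroˡ (h - t)

module _ (G : Graph) where

  start finish : Bool → Fin (m G) → Fin (n G)
  start  b e = if b then tl G e else hd G e
  finish b e = if b then hd G e else tl G e

  start≢finish : ∀ b e → start b e ≢ finish b e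
  start≢finish true  e = noLoop G e
  start≢finish false e = noLoop G e ∘ sym

  step-from : ∀ b e {x y} → start b e ≡ x → finish b e ≡ y →
    if b then (tl G e ≡ x × hd G e ≡ y) else (hd G e ≡ x × tl G e ≡ y)
  step-from true  e p q = p , q
  step-from false e p q = p , q

-- Two orientations with the same boundary: their difference is an Eulerian subgraph,
-- so a walk along differing edges in the direction of P closes up into a cycle.
module DifferenceWalk (G : Graph) (P Q : Orientation G) (same-∂ : ∀ v → ∂ G P v ≡ ∂ G Q v) where

  Differ : Fin (m G) → Set
  Differ e = lookup P e ≢ lookup Q e

  tailP headP : Fin (m G) → Fin (n G)
  tailP e = start  G (lookup P e) e
  headP e = finish G (lookup P e) e

  into outof : Fin (m G) → Fin (n G) → ℤ
  into  e v = entering (lookup P e) (lookup Q e) (hd G e ≐ v) (tl G e ≐ v)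
  outof e v = leaving  (lookup P e) (lookup Q e) (hd G e ≐ v) (tl G e ≐ v)

  balanced : ∀ v → sum (λ e → into e v) ≡ sum (λ e → outof e v)
  balanced v = ℤP.i-j≡0⇒i≡j _ _ (twice≡0 (begin
    + 2 * (sum (λ e → into e v) - sum (λ e → outof e v))
      ≡⟨ cong (+ 2 *_) (sym (sum-sub (λ e → into e v) (λ e → outof e v))) ⟩
    + 2 * sum (λ e → into e v - outof e v)
      ≡⟨ *-distribˡ-sum (+ 2) (λ e → into e v - outof e v) ⟩
    sum (λ e → + 2 * (into e v - outof e v))
      ≡⟨ sum-cong-≗ (λ e → sym (trans (distrib (sgn (lookup P e)) (sgn (lookup Q e)) (inc G e v))
           (sgn-difference (lookup P e) (lookup Q e) (hd G e ≐ v) (tl G e ≐ v)))) ⟩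
    sum (λ e → sgn (lookup P e) * inc G e v - sgn (lookup Q e) * inc G e v)
      ≡⟨ sum-sub (λ e → sgn (lookup P e) * inc G e v) (λ e → sgn (lookup Q e) * inc G e v) ⟩
    ∂ G P v - ∂ G Q v
      ≡⟨ cong (_- ∂ G Q v) (same-∂ v) ⟩
    ∂ G Q v - ∂ G Q v
      ≡⟨ ℤP.+-inverseʳ (∂ G Q v) ⟩
    0ℤ ∎))
    where
    open ≡-Reasoning
    distrib : ∀ a b i → a * i - b * i ≡ (a - b) * i
    distrib = solve-∀

  into-nonneg : ∀ e v → 0ℤ ℤ.≤ into e v
  into-nonneg e v with lookup P e | lookup Q e
  ... | true  | true  = ℤP.≤-refl
  ... | true  | false = ≐-nonneg (hd G e) v
  ... | false | true  = ≐-nonneg (tl G e) v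
  ... | false | false = ℤP.≤-refl

  into-head : ∀ e → Differ e → into e (headP e) ≡ 1ℤ
  into-head e differ with lookup P e | lookup Q e
  ... | true  | true  = ⊥-elim (differ refl)
  ... | true  | false = ≐-self (hd G e)
  ... | false | true  = ≐-self (tl G e)
  ... | false | false = ⊥-elim (differ refl)

  outof≢0 : ∀ e v → outof e v ≢ 0ℤ → Differ e × tailP e ≡ v
  outof≢0 e v ne with lookup P e | lookup Q e
  ... | true  | true  = ⊥-elim (ne refl)
  ... | true  | false = (λ ()) , ≐≢0 (tl G e) v ne
  ... | false | true  = (λ ()) , ≐≢0 (hd G e) v ne
  ... | false | false = ⊥-elim (ne refl)

  continue : ∀ e → Differ e → Σ (Fin (m G)) λ e′ → Differ e′ × tailP e′ ≡ headP e
  continue e differ with FinP.any? (λ e′ → ¬? (outof e′ (headP e) ℤ.≟ 0ℤ))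
  ... | yes (e′ , ne) = e′ , outof≢0 e′ (headP e) ne
  ... | no none = ⊥-elim (1≰0 (begin
    1ℤ                          ≡⟨ sym (into-head e differ) ⟩
    into e (headP e)            ≤⟨ term≤sum _ (λ e′ → into-nonneg e′ (headP e)) e ⟩
    sum (λ e′ → into e′ v)      ≡⟨ balanced v ⟩
    sum (λ e′ → outof e′ v)     ≡⟨ sum-zeros _ no-outof ⟩
    0ℤ                          ∎))
    where
    open ℤP.≤-Reasoning
    v = headP e
    no-outof : ∀ e′ → outof e′ v ≡ 0ℤ
    no-outof e′ with outof e′ v ℤ.≟ 0ℤ
    ... | yes eq = eq
    ... | no ne  = ⊥-elim (none (e′ , λ eq → ne eq))
    1≰0 : ¬ (1ℤ ℤ.≤ 0ℤ)
    1≰0 (ℤ.+≤+ ())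

  DifferingCycle : Set
  DifferingCycle = Σ (OrientedCycle G) λ C →
    ∀ a → OrientedCycle.dir C a ≡ lookup P (OrientedCycle.ed C a) × Differ (OrientedCycle.ed C a)

  module _ (e₀ : Fin (m G)) (d₀ : Differ e₀) where

    walk : ℕ → Σ (Fin (m G)) Differ
    walk zero    = e₀ , d₀
    walk (suc t) = let (e , d) = walk t ; (e′ , d′ , _) = continue e d in e′ , d′

    edge : ℕ → Fin (m G)
    edge t = proj₁ (walk t)

    vertex : ℕ → Fin (n G)
    vertex t = tailP (edge t)

    link : ∀ t → headP (edge t) ≡ vertex (suc t)
    link t = sym (proj₂ (proj₂ (continue (edge t) (proj₂ (walk t)))))

    closed-stretch : ∀ i k → vertex i ≡ vertex (suc (i ℕ.+ suc k)) →
                     InjectiveBelow vertex (suc (i ℕ.+ suc k)) → DifferingCycle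
    closed-stretch i k closes injective = C , λ a → refl , proj₂ (walk (pos a))
      where
      pos : Fin (suc (suc k)) → ℕ
      pos a = i ℕ.+ toℕ a
      pos-bound : ∀ a → pos a ℕ.< suc (i ℕ.+ suc k)
      pos-bound a = s≤s (ℕP.+-monoʳ-≤ i (ℕP.≤-pred (FinP.toℕ<n a)))
      vertex-injective : ∀ {a b} → vertex (pos a) ≡ vertex (pos b) → a ≡ b
      vertex-injective {a} {b} eq with ℕP.<-cmp (toℕ a) (toℕ b)
      ... | tri< a<b _ _ = ⊥-elim (injective (pos a) (pos b) (ℕP.+-monoʳ-< i a<b) (pos-bound b) eq)
      ... | tri≈ _ a≡b _ = FinP.toℕ-injective a≡b
      ... | tri> _ _ b<a = ⊥-elim (injective (pos b) (pos a) (ℕP.+-monoʳ-< i b<a) (pos-bound a) (sym eq))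
      next-vertex : ∀ a → headP (edge (pos a)) ≡ vertex (pos (cycNext a))
      next-vertex a with cycNext-toℕ a
      ... | inj₁ (last , wraps) rewrite wraps | last | ℕP.+-identityʳ i =
        trans (link (i ℕ.+ suc k)) (sym closes)
      ... | inj₂ (_ , increments) rewrite increments | ℕP.+-suc i (toℕ a) = link (i ℕ.+ toℕ a)
      C : OrientedCycle G
      C = record
        { k      = k
        ; vx     = vertex ∘ pos
        ; ed     = edge ∘ pos
        ; dir    = λ a → lookup P (edge (pos a))
        ; vx-inj = vertex-injective
        ; ed-inj = vertex-injective ∘ cong tailP
        ; step   = λ a → step-from G (lookup P (edge (pos a))) (edge (pos a)) refl (next-vertex a)
        }

    -- If P and Q differ on e₀, the differing edges contain a cycle directed in P: the
    -- walk up to its first vertex repetition (a repetition after one step would be a loop).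
    differing-cycle : DifferingCycle
    differing-cycle with first-repetition vertex
    ... | i , j , i<j , repeat , injective with ℕP.m≤n⇒∃[o]m+o≡n i<j
    ...   | zero  , refl = ⊥-elim (start≢finish G (lookup P (edge i)) (edge i)
              (trans repeat (trans (cong vertex (ℕP.+-identityʳ (suc i))) (sym (link i)))))
    ...   | suc k , refl = closed-stretch i k repeat injective

  opposite-cycles : ∀ e₀ → Differ e₀ →
    Σ (Vec ℤ (m G)) λ c → DirectedCycle G P c × DirectedCycle G Q (negV c)
  opposite-cycles e₀ d₀ =
    cycleVec C , agrees⇒directed P C (proj₁ ∘ agrees)
               , subst (DirectedCycle G Q) (cycleVec-reverse C)
                       (agrees⇒directed Q (reverse C) (reversed ∘ mirror))
    where
    open OrientedCycle
    C : OrientedCycle G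
    C = proj₁ (differing-cycle e₀ d₀)
    agrees : ∀ a → dir C a ≡ lookup P (ed C a) × Differ (ed C a)
    agrees = proj₂ (differing-cycle e₀ d₀)
    reversed : ∀ a → not (dir C a) ≡ lookup Q (ed C a)
    reversed a = trans (cong not (proj₁ (agrees a))) (sym (BoolP.¬-not (proj₂ (agrees a) ∘ sym)))

-- Uniqueness: two 𝔠-faithful orientations with the same boundary coincide.  Otherwise
-- faithfulness would orient both a cycle C of differing edges and its reverse -C as in 𝔠.
faithful-unique : (G : Graph) (𝔠 : CycleOrientationConfig G) → IsCOC G 𝔠 →
  ∀ P Q → Faithful G 𝔠 P → Faithful G 𝔠 Q → (∀ v → ∂ G P v ≡ ∂ G Q v) → P ≡ Q
faithful-unique G 𝔠 coc P Q faithfulP faithfulQ same-∂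
  with FinP.any? (λ e → ¬? (lookup P e BoolP.≟ lookup Q e))
... | no agree = vec-ext P Q λ e →
  decidable-stable (lookup P e BoolP.≟ lookup Q e) (λ differ → agree (e , differ))
... | yes (e₀ , d₀) = ⊥-elim (both-in-𝔠 (DifferenceWalk.opposite-cycles G P Q same-∂ e₀ d₀))
  where
  both-in-𝔠 : ¬ (Σ (Vec ℤ (m G)) λ c → DirectedCycle G P c × DirectedCycle G Q (negV c))
  both-in-𝔠 (c , directedP , directedQ) =
    coc c (proj₁ directedP) (trans (faithfulP c directedP) (sym (faithfulQ (negV c) directedQ)))

Searchable : Set → Set₁
Searchable A = ∀ (R : A → Set) → (∀ x → Dec (R x)) → Dec (Σ A R)

searchable-Fin : ∀ {N} → Searchable (Fin N)
searchable-Fin R R? = FinP.any? R?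

searchable-Bool : Searchable Bool
searchable-Bool R R? with R? true | R? false
... | yes r | _     = yes (true , r)
... | no _  | yes r = yes (false , r)
... | no ¬t | no ¬f = no λ { (true , r) → ¬t r ; (false , r) → ¬f r }

searchable-× : ∀ {A B} → Searchable A → Searchable B → Searchable (A × B)
searchable-× searchA searchB R R?
  with searchA (λ a → Σ _ λ b → R (a , b)) (λ a → searchB (λ b → R (a , b)) (λ b → R? (a , b)))
... | yes (a , b , r) = yes ((a , b) , r)
... | no none         = no λ { ((a , b) , r) → none (a , b , r) }

searchable-Vec : ∀ {A} → Searchable A → ∀ l → Searchable (Vec A l)
searchable-Vec searchA zero R R? with R? Vec.[]
... | yes r = yes (Vec.[] , r)
... | no ¬r = no λ { (Vec.[] , r) → ¬r r }
searchable-Vec {A} searchA (suc l) R R?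
  with searchA (λ x → Σ (Vec A l) λ xs → R (x Vec.∷ xs))
               (λ x → searchable-Vec searchA l (λ xs → R (x Vec.∷ xs)) (λ xs → R? (x Vec.∷ xs)))
... | yes (x , xs , r) = yes (x Vec.∷ xs , r)
... | no none          = no λ { (x Vec.∷ xs , r) → none (x , xs , r) }

injective? : ∀ {a b} (f : Fin a → Fin b) → Dec (Injective _≡_ _≡_ f)
injective? f with FinP.all? (λ x → FinP.all? (λ y → (f x Fin.≟ f y) →-dec (x Fin.≟ y)))
... | yes inj = yes (λ {x} {y} → inj x y)
... | no ¬inj = no λ inj → ¬inj (λ x y → inj)

-- Exhaustive search through the oriented cycles of G: an oriented cycle of length l + 2
-- is a triple of vertex, edge and direction lists subject to decidable conditions.
module CycleSearch (G : Graph) where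
  open OrientedCycle

  CycleData : ℕ → Set
  CycleData l = Vec (Fin (n G)) (suc (suc l)) × Vec (Fin (m G)) (suc (suc l)) × Vec Bool (suc (suc l))

  searchable-CycleData : ∀ l → Searchable (CycleData l)
  searchable-CycleData l =
    searchable-× (searchable-Vec searchable-Fin _)
      (searchable-× (searchable-Vec searchable-Fin _) (searchable-Vec searchable-Bool _))

  StepOK : ∀ {l} → CycleData l → Fin (suc (suc l)) → Set
  StepOK (vs , es , ds) i =
    if lookup ds i then (tl G (lookup es i) ≡ lookup vs i × hd G (lookup es i) ≡ lookup vs (cycNext i))
                   else (hd G (lookup es i) ≡ lookup vs i × tl G (lookup es i) ≡ lookup vs (cycNext i))

  step-ok? : ∀ {l} (d : CycleData l) i → Dec (StepOK d i)
  step-ok? (vs , es , ds) i with lookup ds i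
  ... | true  = (tl G (lookup es i) Fin.≟ lookup vs i) ×-dec (hd G (lookup es i) Fin.≟ lookup vs (cycNext i))
  ... | false = (hd G (lookup es i) Fin.≟ lookup vs i) ×-dec (tl G (lookup es i) Fin.≟ lookup vs (cycNext i))

  Valid : ∀ {l} → CycleData l → Set
  Valid d@(vs , es , ds) =
    Injective _≡_ _≡_ (lookup vs) × Injective _≡_ _≡_ (lookup es) × (∀ i → StepOK d i)

  valid? : ∀ {l} (d : CycleData l) → Dec (Valid d)
  valid? d@(vs , es , ds) = injective? (lookup vs) ×-dec (injective? (lookup es) ×-dec FinP.all? (step-ok? d))

  toCycle : ∀ l (d : CycleData l) → Valid d → OrientedCycle G
  toCycle l (vs , es , ds) (vs-inj , es-inj , steps) = record
    { k = l ; vx = lookup vs ; ed = lookup es ; dir = lookup ds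
    ; vx-inj = vs-inj ; ed-inj = es-inj ; step = steps }

  fromCycle : ∀ (C : OrientedCycle G) → Σ (CycleData (k C)) λ d → Σ (Valid d) λ valid →
                cycleVec (toCycle (k C) d valid) ≡ cycleVec C
  fromCycle C = (tabulate (vx C) , tabulate (ed C) , tabulate (dir C))
              , (injective-tabulate (vx-inj C) , injective-tabulate (ed-inj C) , steps)
              , VecP.tabulate-cong λ e → trans (sumFin≡sum (data-traversal e))
                  (trans (sum-cong-≗ (same-terms e)) (sym (sumFin≡sum (traversal C e))))
    where
    at : ∀ {A : Set} {N} (f : Fin N → A) i → lookup (tabulate f) i ≡ f i
    at = VecP.lookup∘tabulate
    injective-tabulate : ∀ {A : Set} {N} {f : Fin N → A} → Injective _≡_ _≡_ f →
                         Injective _≡_ _≡_ (lookup (tabulate f))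
    injective-tabulate {f = f} inj {x} {y} eq = inj (trans (sym (at f x)) (trans eq (at f y)))
    steps : ∀ i → StepOK (tabulate (vx C) , tabulate (ed C) , tabulate (dir C)) i
    steps i rewrite at (dir C) i | at (ed C) i | at (vx C) i | at (vx C) (cycNext i) = step C i
    data-traversal : Fin (m G) → Fin (suc (suc (k C))) → ℤ
    data-traversal e i =
      if does (lookup (tabulate (ed C)) i Fin.≟ e) then sgn (lookup (tabulate (dir C)) i) else 0ℤ
    same-terms : ∀ e i → data-traversal e i ≡ traversal C e i
    same-terms e i rewrite at (ed C) i | at (dir C) i = refl

  -- Distinct edges: a cycle has length at most |E|.
  length-bound : ∀ (C : OrientedCycle G) → k C ℕ.< m G
  length-bound C with suc (suc (k C)) ℕ.≤? m G
  ... | yes fits = ℕP.≤-trans (ℕP.n≤1+n _) fits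
  ... | no too-long with FinP.pigeonhole (ℕP.≰⇒> too-long) (ed C)
  ...   | i , j , i<j , eq = ⊥-elim (FinP.<-irrefl (ed-inj C eq) i<j)

  module _ (R : Vec ℤ (m G) → Set) (R? : ∀ c → Dec (R c)) where

    search-length : ∀ l →
      (Σ (OrientedCycle G) λ C → R (cycleVec C)) ⊎ (∀ (C : OrientedCycle G) → k C ≡ l → ¬ R (cycleVec C))
    search-length l with searchable-CycleData l (λ d → Σ (Valid d) λ valid → R (cycleVec (toCycle l d valid)))
                                               candidate?
      where
      candidate? : ∀ d → Dec (Σ (Valid d) λ valid → R (cycleVec (toCycle l d valid)))
      candidate? d with valid? d
      ... | no invalid = no (invalid ∘ proj₁)
      ... | yes valid with R? (cycleVec (toCycle l d valid))
      ...   | yes r = yes (valid , r)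
      ...   | no ¬r = no (¬r ∘ proj₂)
    ... | yes (d , valid , r) = inj₁ (toCycle l d valid , r)
    ... | no none = inj₂ λ { C refl r → let (d , valid , same) = fromCycle C in
                                         none (d , valid , subst R (sym same) r) }

    search-below : ∀ t →
      (Σ (OrientedCycle G) λ C → R (cycleVec C)) ⊎ (∀ (C : OrientedCycle G) → k C ℕ.< t → ¬ R (cycleVec C))
    search-below zero = inj₂ λ C ()
    search-below (suc t) with search-below t | search-length t
    ... | inj₁ found | _          = inj₁ found
    ... | inj₂ _     | inj₁ found = inj₁ found
    ... | inj₂ below | inj₂ at-t  = inj₂ λ C k<1+t →
      [ below C , at-t C ]′ (ℕP.m≤n⇒m<n∨m≡n (ℕP.≤-pred k<1+t))

    search : (Σ (OrientedCycle G) λ C → R (cycleVec C)) ⊎ (∀ (C : OrientedCycle G) → ¬ R (cycleVec C))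
    search with search-below (m G)
    ... | inj₁ found = inj₁ found
    ... | inj₂ none  = inj₂ λ C → none C (length-bound C)

bit : Bool → Fin 2
bit true  = zero
bit false = suc zero

bit-injective : ∀ {a b} → bit a ≡ bit b → a ≡ b
bit-injective {true}  {true}  _ = refl
bit-injective {false} {false} _ = refl
bit-injective {true}  {false} ()
bit-injective {false} {true}  ()

code : ∀ {l} → Vec Bool l → Fin (2 ^ l)
code v = Fin.funToFin (bit ∘ lookup v)

code-injective : ∀ {l} {v w : Vec Bool l} → code v ≡ code w → v ≡ w
code-injective {v = v} {w} same = vec-ext v w λ i → bit-injective (begin
  bit (lookup v i)                       ≡⟨ sym (FinP.finToFun-funToFin (bit ∘ lookup v) i) ⟩
  Fin.finToFun (code v) i                ≡⟨ cong (λ x → Fin.finToFun x i) same ⟩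
  Fin.finToFun (code w) i                ≡⟨ FinP.finToFun-funToFin (bit ∘ lookup w) i ⟩
  bit (lookup w i)                       ∎)
  where open ≡-Reasoning

module Existence (G : Graph) (𝔠 : CycleOrientationConfig G) (coc : IsCOC G 𝔠)
                 (acyclic : Acyclic G 𝔠) where

  Unfaithful : Orientation G → Vec ℤ (m G) → Set
  Unfaithful P c = DirectedCycle G P c × 𝔠 c ≡ false

  -- the direction condition of 'DirectedCycle', which is decidable
  Follows : Orientation G → Vec ℤ (m G) → Set
  Follows P c = ∀ e → (lookup c e ≡ 1ℤ → lookup P e ≡ true) × (lookup c e ≡ -1ℤ → lookup P e ≡ false)

  unfaithful? : ∀ P c → Dec (Follows P c × 𝔠 c ≡ false)
  unfaithful? P c =
    FinP.all? (λ e → ((lookup c e ℤ.≟ 1ℤ) →-dec (lookup P e BoolP.≟ true))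
                     ×-dec ((lookup c e ℤ.≟ -1ℤ) →-dec (lookup P e BoolP.≟ false)))
    ×-dec (𝔠 c BoolP.≟ false)

  faithful? : ∀ P → (Σ (Vec ℤ (m G)) (Unfaithful P)) ⊎ Faithful G 𝔠 P
  faithful? P with CycleSearch.search G (λ c → Follows P c × 𝔠 c ≡ false) (unfaithful? P)
  ... | inj₁ (C , follows , against) = inj₁ (cycleVec C , ((C , refl) , follows) , against)
  ... | inj₂ none = inj₂ λ { c ((C , refl) , follows) → BoolP.¬-not (λ against → none C (follows , against)) }

  BadReversal : Orientation G → Orientation G → Set
  BadReversal P Q = Σ (Vec ℤ (m G)) λ c → Unfaithful P c × Q ≡ reverseAlong G P c

  gains : ∀ {P Q} → Star BadReversal P Q → List (Vec ℤ (m G))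
  gains ε              = []
  gains ((c , _) ◅ rs) = negV c ∷ gains rs

  gains-in-𝔠 : ∀ {P Q} (rs : Star BadReversal P Q) → All (λ c → IsOCycle G c × 𝔠 c ≡ true) (gains rs)
  gains-in-𝔠 ε = []
  gains-in-𝔠 ((c , ((cycle , _) , against) , _) ◅ rs) =
    (negV-cycle c cycle , BoolP.¬-not (λ eq → coc c cycle (trans against (sym eq)))) ∷ gains-in-𝔠 rs

  sign-change : ∀ {P Q} (rs : Star BadReversal P Q) e →
    sgn (lookup Q e) ≡ sgn (lookup P e) + + 2 * lookup (sumVecs (gains rs)) e
  sign-change {P} ε e = sym (begin
    sgn (lookup P e) + + 2 * lookup (sumVecs {m G} []) e ≡⟨ cong (λ z → sgn (lookup P e) + + 2 * z)
                                                                  (VecP.lookup-replicate e 0ℤ) ⟩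
    sgn (lookup P e) + + 2 * 0ℤ                        ≡⟨ ℤP.+-identityʳ (sgn (lookup P e)) ⟩
    sgn (lookup P e)                                   ∎)
    where open ≡-Reasoning
  sign-change {P} {Q} ((c , (directed , _) , refl) ◅ rs) e = begin
    sgn (lookup Q e)
      ≡⟨ sign-change rs e ⟩
    sgn (lookup (reverseAlong G P c) e) + + 2 * S
      ≡⟨ cong (_+ + 2 * S) (sgn-reverseAlong P c directed e) ⟩
    (sgn (lookup P e) - + 2 * lookup c e) + + 2 * S
      ≡⟨ regroup (sgn (lookup P e)) (lookup c e) S ⟩
    sgn (lookup P e) + + 2 * (- lookup c e + S)
      ≡⟨ cong (λ z → sgn (lookup P e) + + 2 * (z + S)) (sym (VecP.lookup-map e -_ c)) ⟩
    sgn (lookup P e) + + 2 * (lookup (negV c) e + S)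
      ≡⟨ cong (λ z → sgn (lookup P e) + + 2 * z)
              (sym (VecP.lookup-zipWith _+_ e (negV c) (sumVecs (gains rs)))) ⟩
    sgn (lookup P e) + + 2 * lookup (sumVecs (negV c ∷ gains rs)) e ∎
    where
    open ≡-Reasoning
    S = lookup (sumVecs (gains rs)) e
    regroup : ∀ s c S → (s - + 2 * c) + + 2 * S ≡ s + + 2 * (- c + S)
    regroup = solve-∀

  -- No nonempty sequence of bad reversals returns to its start: its gains would be a
  -- nontrivial vanishing nonnegative combination of 𝔠-oriented cycles.
  no-bad-loop : ∀ {P Q} → BadReversal P Q → Star BadReversal Q P → ⊥
  no-bad-loop {P} r rs = nonempty (acyclic (gains loop) (gains-in-𝔠 loop) (vec-ext _ _ vanishes))
    where
    loop : Star BadReversal P P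
    loop = r ◅ rs
    vanishes : ∀ e → lookup (sumVecs (gains loop)) e ≡ lookup (Vec.replicate (m G) 0ℤ) e
    vanishes e = trans (twice≡0 (x≡x+y⇒y≡0 (sign-change loop e))) (sym (VecP.lookup-replicate e 0ℤ))
      where
      x≡x+y⇒y≡0 : ∀ {x y} → x ≡ x + y → y ≡ 0ℤ
      x≡x+y⇒y≡0 {x} {y} eq = trans (sym (cancel x y)) (trans (cong (_- x) (sym eq)) (ℤP.+-inverseʳ x))
        where
        cancel : ∀ x y → (x + y) - x ≡ y
        cancel = solve-∀
    nonempty : ∀ {x : Vec ℤ (m G)} {xs : List (Vec ℤ (m G))} → x ∷ xs ≢ []
    nonempty ()

  advance : ∀ P → (Σ (Vec ℤ (m G)) (Unfaithful P)) ⊎ Faithful G 𝔠 P → Orientation G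
  advance P (inj₁ (c , _)) = reverseAlong G P c
  advance P (inj₂ _)       = P

  advance-spec : ∀ P d → BadReversal P (advance P d) ⊎ Faithful G 𝔠 P
  advance-spec P (inj₁ (c , unfaithful)) = inj₁ (c , unfaithful , refl)
  advance-spec P (inj₂ faithful)         = inj₂ faithful

  module _ (O : Orientation G) where

    orbit : ℕ → Orientation G
    orbit zero    = O
    orbit (suc t) = advance (orbit t) (faithful? (orbit t))

    AllBad : ℕ → Set
    AllBad t = ∀ s → s ℕ.< t → BadReversal (orbit s) (orbit (suc s))

    segment : ∀ {t} → AllBad t → ∀ d a → d ℕ.+ a ℕ.≤ t → Star BadReversal (orbit a) (orbit (d ℕ.+ a))
    segment bad zero    a _     = ε
    segment bad (suc d) a bound = segment bad d a (ℕP.<⇒≤ bound) ◅◅ (bad (d ℕ.+ a) bound ◅ ε)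

    orbit-injective : ∀ {t} → AllBad t → ∀ {i j} → i ℕ.< j → j ℕ.≤ t → orbit i ≢ orbit j
    orbit-injective {t} bad {i} i<j j≤t same with ℕP.m≤n⇒∃[o]m+o≡n i<j
    ... | d , refl = no-bad-loop closing (segment bad d i (ℕP.<⇒≤ bound))
      where
      bound : suc (d ℕ.+ i) ℕ.≤ t
      bound = subst (λ x → suc x ℕ.≤ t) (ℕP.+-comm i d) j≤t
      closing : BadReversal (orbit (d ℕ.+ i)) (orbit i)
      closing = subst (BadReversal (orbit (d ℕ.+ i)))
                      (trans (cong (orbit ∘ suc) (ℕP.+-comm d i)) (sym same)) (bad (d ℕ.+ i) bound)

    Found : Set
    Found = Σ (Orientation G) λ O′ → Faithful G 𝔠 O′ × Reaches G O O′

    to-reaches : ∀ {P Q} → Star BadReversal P Q → Reaches G P Q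
    to-reaches = Star.map λ { (c , (directed , _) , eq) → c , directed , eq }

    run : ∀ t → Found ⊎ AllBad t
    run zero = inj₂ λ _ ()
    run (suc t) with run t
    ... | inj₁ found = inj₁ found
    ... | inj₂ bad with advance-spec (orbit t) (faithful? (orbit t))
    ...   | inj₂ faithful = inj₁ (orbit t , faithful , to-reaches from-start)
      where
      from-start : Star BadReversal O (orbit t)
      from-start = subst (Star BadReversal O) (cong orbit (ℕP.+-identityʳ t))
                         (segment bad t 0 (ℕP.≤-reflexive (ℕP.+-identityʳ t)))
    ...   | inj₁ r        = inj₂ λ s s<1+t → [ bad s , (λ { refl → r }) ]′ (ℕP.m≤n⇒m<n∨m≡n (ℕP.≤-pred s<1+t))

    -- There are only 2^|E| orientations, so 2^|E| + 1 bad steps are impossible.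
    exists : Found
    exists with run (suc (2 ^ m G))
    ... | inj₁ found = found
    ... | inj₂ bad with FinP.pigeonhole (ℕP.n<1+n (2 ^ m G)) (code ∘ orbit ∘ toℕ)
    ...   | a , b , a<b , same-code =
      ⊥-elim (orbit-injective bad a<b (ℕP.<⇒≤ (FinP.toℕ<n b)) (code-injective same-code))

proposition3p8 : (G : Graph) → Connected G →
    (𝔠 : CycleOrientationConfig G) → IsCOC G 𝔠 → Acyclic G 𝔠 →
    (O : Orientation G) →
      Σ (Orientation G) λ O' → (Faithful G 𝔠 O' × Reaches G O O') ×
        ((O'' : Orientation G) → Faithful G 𝔠 O'' → Reaches G O O'' → O'' ≡ O')
proposition3p8 G _ 𝔠 coc acyclic O = representative (Existence.exists G 𝔠 coc acyclic O)
  where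
  -- any faithful orientation in the class of O is the one found: both have the boundary of O
  representative : (Σ (Orientation G) λ O′ → Faithful G 𝔠 O′ × Reaches G O O′) →
    Σ (Orientation G) λ O' → (Faithful G 𝔠 O' × Reaches G O O') ×
      ((O'' : Orientation G) → Faithful G 𝔠 O'' → Reaches G O O'' → O'' ≡ O')
  representative (O′ , faithful′ , reaches′) = O′ , (faithful′ , reaches′) , λ O″ faithful″ reaches″ →
    faithful-unique G 𝔠 coc O″ O′ faithful″ faithful′
      (λ v → trans (sym (∂-Reaches reaches″ v)) (∂-Reaches reaches′ v))
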